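{- For every connected graph $G$ of order $n$, $\alpha_{bn}(G)\le n-\delta(G)$, where $\delta(G)$ is the minimum degree of $G$.
   Context: A broadcast on a connected graph $G$ is a function $f:V(G)\to\{0,1,\dots,\operatorname{diam}(G)\}$ with $f(v)\le e(v)$ (the eccentricity of $v$) for every $v$. Let $V_f^+=\{v: f(v)>0\}$. A vertex $u$ hears $f$ from $v\in V_f^+$ if $d_G(u,v)\le f(v)$; $N_f(v)$ is the set of vertices hearing $f$ from $v$ (including $v$), $PN_f(v)$ the set of vertices hearing $f$ only from $v$, and $B_f(v)=\{u\in N_f(v): d_G(u,v)=f(v)\}$. The broadcast $f$ is boundary independent if $N_f(v)\setminus B_f(v)\subseteq PN_f(v)$ for all $v\in V_f^+$. The cost is $\sigma(f)=\sum_v f(v)$, and $\alpha_{bn}(G)$ is the maximum cost of a boundary independent broadcast on $G$ (for the one-vertex graph this is $0$). -}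

module Defs where

open import Data.Nat using (ℕ; zero; suc; _+_; _∸_; _≤_; _<_; _⊓_)
open import Data.Fin using (Fin)
open import Data.Bool using (Bool; true; false; if_then_else_)
open import Data.List using (List; map; foldr; allFin)
open import Data.Nat.ListAction using (sum)
open import Data.Product using (Σ; _×_; ∃)
open import Relation.Binary.PropositionalEquality using (_≡_)
open import Relation.Nullary using (¬_)

record Graph (n : ℕ) : Set where
  field
    adj     : Fin n → Fin n → Bool
    adj-sym : ∀ u v → adj u v ≡ adj v u
    adj-irr : ∀ v → adj v v ≡ false
open Graph public

data Walk {n : ℕ} (G : Graph n) : Fin n → Fin n → ℕ → Set where
  here : ∀ {v} → Walk G v v 0
  step : ∀ {u w v k} → adj G u w ≡ true → Walk G w v k → Walk G u v (suc k)

Dist≤ : ∀ {n} → Graph n → Fin n → Fin n → ℕ → Set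
Dist≤ G u v k = Σ ℕ λ j → j ≤ k × Walk G u v j

IsDist : ∀ {n} → Graph n → Fin n → Fin n → ℕ → Set
IsDist G u v d = Dist≤ G u v d × (∀ k → Dist≤ G u v k → d ≤ k)

Connected : ∀ {n} → Graph n → Set
Connected G = ∀ u v → ∃ λ k → Walk G u v k

IsEcc : ∀ {n} → Graph n → Fin n → ℕ → Set
IsEcc G v e = (∀ u → Dist≤ G v u e) × ∃ λ u → IsDist G v u e

degree : ∀ {n} → Graph n → Fin n → ℕ
degree {n} G v = sum (map (λ u → if adj G v u then 1 else 0) (allFin n))

minDegree : ∀ {m} → Graph (suc m) → ℕ
minDegree {m} G = foldr _⊓_ (degree G Fin.zero) (map (degree G) (allFin (suc m)))

-- Broadcasts: f v ≤ e(v) for every v (this also forces f v ≤ diam G)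
IsBroadcast : ∀ {n} → Graph n → (Fin n → ℕ) → Set
IsBroadcast G f = ∀ v e → IsEcc G v e → f v ≤ e

Hears : ∀ {n} → Graph n → (Fin n → ℕ) → Fin n → Fin n → Set
Hears G f u v = (0 < f v) × Dist≤ G v u (f v)

InBoundary : ∀ {n} → Graph n → (Fin n → ℕ) → Fin n → Fin n → Set
InBoundary G f u v = Hears G f u v × IsDist G v u (f v)

-- N_f(v) \ B_f(v) ⊆ PN_f(v) for every v ∈ V_f^+
BoundaryIndependent : ∀ {n} → Graph n → (Fin n → ℕ) → Set
BoundaryIndependent G f =
  ∀ v u → Hears G f u v → ¬ InBoundary G f u v → ∀ w → Hears G f u w → w ≡ v

cost : ∀ {n} → (Fin n → ℕ) → ℕ
cost {n} f = sum (map f (allFin n))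

-- Pick a broadcasting vertex v. For every broadcasting vertex w, the vertices at
-- distances 0, 1, …, f(w) − 1 along a geodesic from w to a vertex of maximal
-- distance lie strictly inside the ball of w, so by boundary independence they
-- hear f from w only. For v, replace the vertex at distance 1 by all neighbours
-- of v and add the geodesic vertex at distance f(v): all of these still hear v.
-- The resulting blocks are duplicate-free and pairwise disjoint, and together
-- they contain at least σ(f) + deg(v) ≥ σ(f) + δ(G) vertices.
module Submission where

open import Defs
open import Data.Nat using (ℕ; zero; suc; _+_; _∸_; _≤_; _<_; _⊓_; z≤n; s≤s)
open import Data.Nat.Properties
open import Data.Nat.Induction using (<-wellFounded)
open import Data.Nat.ListAction using (sum)
open import Data.Fin using (Fin)
open import Data.Fin.Properties using (any?; injective⇒≤) renaming (_≟_ to _≟ᶠ_)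
open import Data.Bool using (Bool; true; false; if_then_else_)
open import Data.Bool.Properties using () renaming (_≟_ to _≟ᵇ_)
open import Data.List using (List; []; _∷_; _++_; map; foldr; allFin; length; filter; applyUpTo; concatMap; lookup)
open import Data.List.Properties using (length-++; length-applyUpTo)
open import Data.List.Relation.Unary.All as All using (All)
open import Data.List.Relation.Unary.Any using (here; there)
open import Data.List.Membership.Propositional using (_∈_)
open import Data.List.Membership.Propositional.Properties
  using (∈-allFin; ∈-++⁻; ∈-lookup; ∈-filter⁻; ∈-applyUpTo⁻)
open import Data.List.Extrema.Nat using (argmax; f[xs]≤f[argmax])
open import Data.List.Relation.Unary.AllPairs as AllPairs using (_∷_)
import Data.List.Relation.Unary.AllPairs.Properties as AllPairsₚ
import Data.List.Relation.Unary.All.Properties as Allₚ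
open import Data.List.Relation.Unary.Unique.Propositional using (Unique)
import Data.List.Relation.Unary.Unique.Propositional.Properties as Uniqueₚ
open import Data.Product using (∃; ∃₂; _×_; _,_; proj₁; proj₂)
open import Data.Sum using (_⊎_; inj₁; inj₂)
open import Data.Empty using (⊥-elim)
open import Function using (_∘_)
open import Induction.WellFounded using (Acc; acc)
open import Relation.Nullary using (¬_; Dec; yes; no; contradiction)
open import Relation.Nullary.Decidable using (_×-dec_)
open import Relation.Unary using (Pred; Decidable)
open import Relation.Binary.PropositionalEquality

least-witness : ∀ {p} {P : Pred ℕ p} → Decidable P →
                ∀ {k} → P k → ∃ λ j → P j × (∀ i → P i → j ≤ i)
least-witness {P = P} P? {k} pk = go k (<-wellFounded k) pk
  where
  go : ∀ k → Acc _<_ k → P k → ∃ λ j → P j × (∀ i → P i → j ≤ i)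
  go k (acc smaller) pk with anyUpTo? P? k
  ... | yes (i , i<k , pi) = go i (smaller i<k) pi
  ... | no ∄smaller = k , pk , λ i pi → ≮⇒≥ λ i<k → ∄smaller (i , i<k , pi)

sum-map-positive : ∀ {A : Set} (g : A → ℕ) xs → 0 < sum (map g xs) →
                   ∃₂ λ x k → g x ≡ suc k
sum-map-positive g (x ∷ xs) pos with g x in gx≡
... | zero  = sum-map-positive g xs pos
... | suc k = x , k , gx≡

sum-map-mono : ∀ {A : Set} {g h : A → ℕ} → (∀ x → g x ≤ h x) →
               ∀ xs → sum (map g xs) ≤ sum (map h xs)
sum-map-mono g≤h []       = z≤n
sum-map-mono g≤h (x ∷ xs) = +-mono-≤ (g≤h x) (sum-map-mono g≤h xs)

sum-map-mono-+ : ∀ {A : Set} {g h : A → ℕ} {c x xs} → (∀ y → g y ≤ h y) →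
                 g x + c ≤ h x → x ∈ xs → sum (map g xs) + c ≤ sum (map h xs)
sum-map-mono-+ {g = g} {c = c} {x} {_ ∷ xs} g≤h gx+c≤hx (here refl) = begin
  g x + sum (map g xs) + c   ≡⟨ +-assoc (g x) _ c ⟩
  g x + (sum (map g xs) + c) ≡⟨ cong (g x +_) (+-comm _ c) ⟩
  g x + (c + sum (map g xs)) ≡⟨ +-assoc (g x) c _ ⟨
  g x + c + sum (map g xs)   ≤⟨ +-mono-≤ gx+c≤hx (sum-map-mono g≤h xs) ⟩
  _                          ∎
  where open ≤-Reasoning
sum-map-mono-+ {g = g} {h} {c} {xs = y ∷ ys} g≤h gx+c≤hx (there x∈xs) =
  subst (_≤ sum (map h (y ∷ ys))) (sym (+-assoc (g y) _ c))
    (+-mono-≤ (g≤h y) (sum-map-mono-+ g≤h gx+c≤hx x∈xs))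

foldr-⊓-map-≤ : ∀ {A : Set} (g : A → ℕ) d {x xs} → x ∈ xs → foldr _⊓_ d (map g xs) ≤ g x
foldr-⊓-map-≤ g d (here refl) = m⊓n≤m (g _) _
foldr-⊓-map-≤ g d (there x∈xs) = ≤-trans (m⊓n≤n (g _) _) (foldr-⊓-map-≤ g d x∈xs)

length-filter-≡-count : ∀ {A : Set} (b : A → Bool) xs →
  length (filter (λ x → b x ≟ᵇ true) xs) ≡ sum (map (λ x → if b x then 1 else 0) xs)
length-filter-≡-count b []       = refl
length-filter-≡-count b (x ∷ xs) with b x
... | true  = cong suc (length-filter-≡-count b xs)
... | false = length-filter-≡-count b xs

Unique⇒lookup-injective : ∀ {A : Set} {xs : List A} → Unique xs →
                          ∀ {i j} → lookup xs i ≡ lookup xs j → i ≡ j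
Unique⇒lookup-injective (_ ∷ _)   {Fin.zero}  {Fin.zero}  _  = refl
Unique⇒lookup-injective (x∉ ∷ _)  {Fin.zero}  {Fin.suc j} eq = ⊥-elim (All.lookup x∉ (∈-lookup j) eq)
Unique⇒lookup-injective (x∉ ∷ _)  {Fin.suc i} {Fin.zero}  eq = ⊥-elim (All.lookup x∉ (∈-lookup i) (sym eq))
Unique⇒lookup-injective (_ ∷ xs!) {Fin.suc i} {Fin.suc j} eq = cong Fin.suc (Unique⇒lookup-injective xs! eq)

Unique⇒length≤ : ∀ {n} {xs : List (Fin n)} → Unique xs → length xs ≤ n
Unique⇒length≤ xs! = injective⇒≤ (Unique⇒lookup-injective xs!)

length-concatMap : ∀ {A B : Set} (g : A → List B) xs →
                   length (concatMap g xs) ≡ sum (map (length ∘ g) xs)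
length-concatMap g []       = refl
length-concatMap g (x ∷ xs) = trans (length-++ (g x)) (cong (length (g x) +_) (length-concatMap g xs))

module _ {n} {A : Set} (B : A → List (Fin n))
         (B-unique : ∀ a → Unique (B a))
         (B-disjoint : ∀ {a b x} → x ∈ B a → x ∈ B b → a ≡ b) where

  concatMap-unique : ∀ {xs} → Unique xs → Unique (concatMap B xs)
  concatMap-unique {xs} xs! = Uniqueₚ.concat⁺
    (Allₚ.map⁺ (All.universal B-unique xs))
    (AllPairsₚ.map⁺ (AllPairs.map (λ a≢b {_} (x∈a , x∈b) → a≢b (B-disjoint x∈a x∈b)) xs!))

  sum-length-disjoint≤ : ∀ {xs} → Unique xs → sum (map (length ∘ B) xs) ≤ n
  sum-length-disjoint≤ {xs} xs! =
    subst (_≤ n) (length-concatMap B xs) (Unique⇒length≤ (concatMap-unique xs!))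

module _ {n : ℕ} {G : Graph n} where

  _++ʷ_ : ∀ {u w v j k} → Walk G u w j → Walk G w v k → Walk G u v (j + k)
  here     ++ʷ q = q
  step e p ++ʷ q = step e (p ++ʷ q)

  Walk-0⇒≡ : ∀ {u v} → Walk G u v 0 → u ≡ v
  Walk-0⇒≡ here = refl

  walk? : ∀ k u v → Dec (Walk G u v k)
  walk? zero u v with u ≟ᶠ v
  ... | yes refl = yes here
  ... | no u≢v   = no (u≢v ∘ Walk-0⇒≡)
  walk? (suc k) u v with any? (λ w → (adj G u w ≟ᵇ true) ×-dec walk? k w v)
  ... | yes (w , e , p) = yes (step e p)
  ... | no ∄w           = no λ { (step e p) → ∄w (_ , e , p) }

  vertexAt : ∀ {u v k} → Walk G u v k → ℕ → Fin n
  vertexAt {u} here       _       = u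
  vertexAt {u} (step _ _) zero    = u
  vertexAt     (step _ p) (suc i) = vertexAt p i

  walk-to-vertexAt : ∀ {u v k i} (p : Walk G u v k) → i ≤ k → Walk G u (vertexAt p i) i
  walk-to-vertexAt here       z≤n       = here
  walk-to-vertexAt (step _ _) z≤n       = here
  walk-to-vertexAt (step e p) (s≤s i≤k) = step e (walk-to-vertexAt p i≤k)

  walk-from-vertexAt : ∀ {u v k i} (p : Walk G u v k) → i ≤ k → Walk G (vertexAt p i) v (k ∸ i)
  walk-from-vertexAt here       z≤n       = here
  walk-from-vertexAt (step e p) z≤n       = step e p
  walk-from-vertexAt (step _ p) (s≤s i≤k) = walk-from-vertexAt p i≤k

  Walk⇒Dist≤ : ∀ {u v k} → Walk G u v k → Dist≤ G u v k
  Walk⇒Dist≤ p = _ , ≤-refl , p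

  Dist≤-weaken : ∀ {u v j k} → Dist≤ G u v j → j ≤ k → Dist≤ G u v k
  Dist≤-weaken (l , l≤j , p) j≤k = l , ≤-trans l≤j j≤k , p

  IsDist-refl : ∀ {v} → IsDist G v v 0
  IsDist-refl = Walk⇒Dist≤ here , λ _ _ → z≤n

  IsDist-unique : ∀ {u v d d′} → IsDist G u v d → IsDist G u v d′ → d ≡ d′
  IsDist-unique (d , d-min) (d′ , d′-min) = ≤-antisym (d-min _ d′) (d′-min _ d)

  IsDist⇒Walk : ∀ {u v d} → IsDist G u v d → Walk G u v d
  IsDist⇒Walk ((j , j≤d , p) , d-min) =
    subst (Walk G _ _) (≤-antisym j≤d (d-min j (Walk⇒Dist≤ p))) p

  vertexAt-IsDist : ∀ {u v k i} → IsDist G u v k → (p : Walk G u v k) → i ≤ k →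
                    IsDist G u (vertexAt p i) i
  vertexAt-IsDist {k = k} {i} (_ , k-min) p i≤k = Walk⇒Dist≤ (walk-to-vertexAt p i≤k) , i-min
    where
    i-min : ∀ j → Dist≤ G _ (vertexAt p i) j → i ≤ j
    i-min j (l , l≤j , q) = ≤-trans (+-cancelʳ-≤ (k ∸ i) i l i+rest≤l+rest) l≤j
      where
      i+rest≤l+rest : i + (k ∸ i) ≤ l + (k ∸ i)
      i+rest≤l+rest = subst (_≤ l + (k ∸ i)) (sym (m+[n∸m]≡n i≤k))
        (k-min _ (Walk⇒Dist≤ (q ++ʷ walk-from-vertexAt p i≤k)))

  -- Opaque: nothing below depends on how the witnesses are computed, and
  -- unfolding the search during unification is prohibitively expensive.
  opaque
    distance : Connected G → ∀ u v → ∃ (IsDist G u v)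
    distance conn u v with least-witness (λ k → walk? k u v) (proj₂ (conn u v))
    ... | d , p , d-min = d , Walk⇒Dist≤ p , λ { k (j , j≤k , q) → ≤-trans (d-min j q) j≤k }

    eccentricity : Connected G → ∀ v → ∃ (IsEcc G v)
    eccentricity conn v = dist v far , all-within , far , proj₂ (distance conn v far)
      where
      dist : Fin n → Fin n → ℕ
      dist u w = proj₁ (distance conn u w)
      far : Fin n
      far = argmax (dist v) v (allFin n)
      all-within : ∀ u → Dist≤ G v u (dist v far)
      all-within u = Dist≤-weaken (proj₁ (proj₂ (distance conn v u)))
        (All.lookup (f[xs]≤f[argmax] v (allFin n)) (∈-allFin u))

HearsOnly : ∀ {n} → Graph n → (Fin n → ℕ) → Fin n → Fin n → Set
HearsOnly G f u v = ∀ w → Hears G f u w → w ≡ v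

module _ {n} {G : Graph n} {f : Fin n → ℕ} where

  hears-within : ∀ {w x i} → IsDist G w x i → i < f w → Hears G f x w
  hears-within dist i<fw = ≤-trans (s≤s z≤n) i<fw , Dist≤-weaken (proj₁ dist) (<⇒≤ i<fw)

  hears-only-within : BoundaryIndependent G f →
                      ∀ {w x i} → IsDist G w x i → i < f w → HearsOnly G f x w
  hears-only-within bi {w} {x} dist i<fw = bi w x (hears-within dist i<fw) not-boundary
    where
    not-boundary : ¬ InBoundary G f x w
    not-boundary (_ , dist′) = <-irrefl (IsDist-unique dist dist′) i<fw

  hears-same-source : ∀ {v x a b} → Hears G f x a → Hears G f x b →
                      a ≡ v ⊎ HearsOnly G f x a → b ≡ v ⊎ HearsOnly G f x b → a ≡ b
  hears-same-source _  _  (inj₁ a≡v)  (inj₁ b≡v)  = trans a≡v (sym b≡v)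
  hears-same-source _  hb (inj₂ only) _           = sym (only _ hb)
  hears-same-source ha _  (inj₁ _)    (inj₂ only) = only _ ha

module Blocks {n} (G : Graph n) (conn : Connected G) (f : Fin n → ℕ)
  (isB : IsBroadcast G f) (bi : BoundaryIndependent G f) where

  private
    ecc : Fin n → ℕ
    ecc w = proj₁ (eccentricity conn w)

    far : Fin n → Fin n
    far w = proj₁ (proj₂ (proj₂ (eccentricity conn w)))

    far-IsDist : ∀ w → IsDist G w (far w) (ecc w)
    far-IsDist w = proj₂ (proj₂ (proj₂ (eccentricity conn w)))

    f≤ecc : ∀ w → f w ≤ ecc w
    f≤ecc w = isB w (ecc w) (proj₂ (eccentricity conn w))

    geodesic : ∀ w → Walk G w (far w) (ecc w)
    geodesic w = IsDist⇒Walk (far-IsDist w)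

  layer : Fin n → ℕ → Fin n
  layer w = vertexAt (geodesic w)

  layer-IsDist : ∀ w {i} → i ≤ f w → IsDist G w (layer w i) i
  layer-IsDist w i≤fw = vertexAt-IsDist (far-IsDist w) (geodesic w) (≤-trans i≤fw (f≤ecc w))

  layers-unique : ∀ w (g : ℕ → ℕ) k → (∀ {i} → i < k → g i ≤ f w) →
                  (∀ {i j} → i < j → j < k → g i < g j) → Unique (applyUpTo (layer w ∘ g) k)
  layers-unique w g k bounded increasing = Uniqueₚ.applyUpTo⁺₁ _ k λ i<j j<k eq →
    <⇒≢ (increasing i<j j<k)
      (IsDist-unique (layer-IsDist w (bounded (<-trans i<j j<k)))
        (subst (λ x → IsDist G w x _) (sym eq) (layer-IsDist w (bounded j<k))))

  interior : Fin n → List (Fin n)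
  interior w = applyUpTo (layer w) (f w)

  interior-unique : ∀ w → Unique (interior w)
  interior-unique w = layers-unique w (λ i → i) (f w) <⇒≤ (λ i<j _ → i<j)

  ∈-interior⇒hears-only : ∀ {w x} → x ∈ interior w → Hears G f x w × HearsOnly G f x w
  ∈-interior⇒hears-only {w} x∈ with ∈-applyUpTo⁻ (layer w) x∈
  ... | i , i<fw , refl = hears-within {f = f} dist i<fw , hears-only-within bi dist i<fw
    where
    dist : IsDist G w (layer w i) i
    dist = layer-IsDist w (<⇒≤ i<fw)

  module Enlarged (v : Fin n) {k} (fv≡1+k : f v ≡ suc k) where

    neighbours : List (Fin n)
    neighbours = filter (λ u → adj G v u ≟ᵇ true) (allFin n)

    outer : List (Fin n)
    outer = applyUpTo (layer v ∘ (2 +_)) k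

    interior⁺ : List (Fin n)
    interior⁺ = v ∷ neighbours ++ outer

    outer-IsDist : ∀ {x} → x ∈ outer → ∃ λ i → 2 + i ≤ f v × IsDist G v x (2 + i)
    outer-IsDist x∈ with ∈-applyUpTo⁻ _ x∈
    ... | i , i<k , refl = i , 2+i≤fv , layer-IsDist v 2+i≤fv
      where
      2+i≤fv : 2 + i ≤ f v
      2+i≤fv = subst (2 + i ≤_) (sym fv≡1+k) (s≤s i<k)

    ∈-neighbours⁻ : ∀ {x} → x ∈ neighbours → adj G v x ≡ true
    ∈-neighbours⁻ x∈ = proj₂ (∈-filter⁻ (λ u → adj G v u ≟ᵇ true) {xs = allFin n} x∈)

    ∈-interior⁺⇒hears : ∀ {x} → x ∈ interior⁺ → Hears G f x v
    ∈-interior⁺⇒hears x∈ = 0<fv , within x∈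
      where
      0<fv : 0 < f v
      0<fv = subst (0 <_) (sym fv≡1+k) (s≤s z≤n)
      within : ∀ {x} → x ∈ interior⁺ → Dist≤ G v x (f v)
      within (here refl) = Dist≤-weaken (proj₁ IsDist-refl) z≤n
      within (there x∈) with ∈-++⁻ neighbours x∈
      ... | inj₁ x∈nbs = Dist≤-weaken (Walk⇒Dist≤ (step (∈-neighbours⁻ x∈nbs) here)) 0<fv
      ... | inj₂ x∈out with outer-IsDist x∈out
      ...   | _ , 2+i≤fv , dist = Dist≤-weaken (proj₁ dist) 2+i≤fv

    interior⁺-unique : Unique interior⁺
    interior⁺-unique = All.tabulate v∉ ∷ Uniqueₚ.++⁺ neighbours-unique outer-unique disjoint
      where
      neighbours-unique : Unique neighbours
      neighbours-unique = Uniqueₚ.filter⁺ _ (Uniqueₚ.allFin⁺ n)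
      outer-unique : Unique outer
      outer-unique = layers-unique v (2 +_) k
        (λ i<k → subst (_ ≤_) (sym fv≡1+k) (s≤s i<k)) (λ i<j _ → s≤s (s≤s i<j))
      v∉ : ∀ {x} → x ∈ neighbours ++ outer → v ≢ x
      v∉ x∈ refl with ∈-++⁻ neighbours x∈
      ... | inj₁ v∈nbs = contradiction (trans (sym (adj-irr G v)) (∈-neighbours⁻ v∈nbs)) λ ()
      ... | inj₂ v∈out with outer-IsDist v∈out
      ...   | _ , _ , dist with IsDist-unique dist IsDist-refl
      ...     | ()
      disjoint : ∀ {x} → ¬ (x ∈ neighbours × x ∈ outer)
      disjoint (x∈nbs , x∈out) with outer-IsDist x∈out
      ... | _ , _ , (_ , min) with min 1 (Walk⇒Dist≤ (step (∈-neighbours⁻ x∈nbs) here))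
      ...   | s≤s ()

    interior⁺-length : f v + degree G v ≡ length interior⁺
    interior⁺-length = begin
      f v + degree G v                       ≡⟨ cong (_+ degree G v) fv≡1+k ⟩
      suc (k + degree G v)                   ≡⟨ cong suc (+-comm k _) ⟩
      suc (degree G v + k)                   ≡⟨ cong suc (cong₂ _+_ (length-filter-≡-count (adj G v) (allFin n))
                                                                   (length-applyUpTo _ k)) ⟨
      suc (length neighbours + length outer) ≡⟨ cong suc (length-++ neighbours) ⟨
      length interior⁺                       ∎
      where open ≡-Reasoning

    block : Fin n → List (Fin n)
    block w with w ≟ᶠ v
    ... | yes _ = interior⁺
    ... | no  _ = interior w

    block-unique : ∀ w → Unique (block w)
    block-unique w with w ≟ᶠ v
    ... | yes _ = interior⁺-unique
    ... | no  _ = interior-unique w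

    ∈-block⇒hears : ∀ {w x} → x ∈ block w → Hears G f x w × (w ≡ v ⊎ HearsOnly G f x w)
    ∈-block⇒hears {w} x∈ with w ≟ᶠ v
    ... | yes refl = ∈-interior⁺⇒hears x∈ , inj₁ refl
    ... | no  _    = proj₁ (∈-interior⇒hears-only x∈) , inj₂ (proj₂ (∈-interior⇒hears-only x∈))

    block-disjoint : ∀ {a b x} → x ∈ block a → x ∈ block b → a ≡ b
    block-disjoint x∈a x∈b with ∈-block⇒hears x∈a | ∈-block⇒hears x∈b
    ... | ha , a-src | hb , b-src = hears-same-source ha hb a-src b-src

    f≤length-block : ∀ w → f w ≤ length (block w)
    f≤length-block w with w ≟ᶠ v
    ... | yes refl = ≤-trans (m≤m+n (f v) _) (≤-reflexive interior⁺-length)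
    ... | no  _    = ≤-reflexive (sym (length-applyUpTo _ (f w)))

    f+degree≤length-block : f v + degree G v ≤ length (block v)
    f+degree≤length-block with v ≟ᶠ v
    ... | yes _   = ≤-reflexive interior⁺-length
    ... | no  v≢v = contradiction refl v≢v

    cost+degree≤order : cost f + degree G v ≤ n
    cost+degree≤order = ≤-trans
      (sum-map-mono-+ f≤length-block f+degree≤length-block (∈-allFin v))
      (sum-length-disjoint≤ block block-unique block-disjoint (Uniqueₚ.allFin⁺ n))

theorem3p3 : (m : ℕ) (G : Graph (suc m)) → Connected G →
    (f : Fin (suc m) → ℕ) → IsBroadcast G f → BoundaryIndependent G f →
    cost f ≤ suc m ∸ minDegree G
theorem3p3 m G conn f isB bi with 0 <? cost f
... | no  cost≯0 = ≤-trans (≮⇒≥ cost≯0) z≤n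
... | yes cost>0 with sum-map-positive f (allFin (suc m)) cost>0
...   | v , _ , fv≡1+k = m+n≤o⇒m≤o∸n (cost f) (begin
  cost f + minDegree G ≤⟨ +-monoʳ-≤ (cost f) (foldr-⊓-map-≤ (degree G) _ (∈-allFin v)) ⟩
  cost f + degree G v  ≤⟨ Blocks.Enlarged.cost+degree≤order G conn f isB bi v fv≡1+k ⟩
  suc m                ∎)
  where open ≤-Reasoning
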